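{- The class of decisive graphs is hereditary: every induced subgraph of a decisive graph is a decisive graph.
   Context: For a graphic list $d=(d_1,\dots,d_n)$, let $P(d)\subseteq\mathbb{R}^{\binom{n}{2}}$ be the polytope of all $x=(x_{ij})$ (indexed by unordered pairs of distinct elements of $[n]$) with $\sum_{i\neq j}x_{ij}=d_j$ for all $j\in[n]$ and $0\le x_{ij}\le 1$ for all $i<j$. The list $d$ is decisive if every vertex of $P(d)$ has all coordinates in $\{0,1\}$. A decisive graph is a simple graph whose degree sequence is decisive.
   Formalization: The polytope $P(d)$ and its vertices are taken over ℚ instead of ℝ, with rational points and rational coefficients in the convex combinations that define a vertex. -}

module Defs where

open import Data.Nat using (ℕ; zero; suc)
open import Data.Fin using (Fin; zero; suc)
import Data.Integer
open import Data.Bool using (Bool; true; false)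
open import Data.Rational using (ℚ; 0ℚ; 1ℚ; _+_; _*_; _-_; _≤_; _<_)
open import Data.Product using (_×_)
open import Data.Sum using (_⊎_)
open import Relation.Binary.PropositionalEquality using (_≡_)
open import Function.Definitions using (Injective)

sumℚ : (n : ℕ) → (Fin n → ℚ) → ℚ
sumℚ zero    f = 0ℚ
sumℚ (suc n) f = f zero + sumℚ n (λ i → f (suc i))

sumℕ : (n : ℕ) → (Fin n → ℕ) → ℕ
sumℕ zero    f = 0
sumℕ (suc n) f = f zero Data.Nat.+ sumℕ n (λ i → f (suc i))

record Graph (n : ℕ) : Set where
  field
    adj    : Fin n → Fin n → Bool
    sym    : ∀ i j → adj i j ≡ adj j i
    irrefl : ∀ i → adj i i ≡ false
open Graph public

b2n : Bool → ℕ
b2n true  = 1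
b2n false = 0

degSeq : ∀ {n} → Graph n → Fin n → ℕ
degSeq {n} G j = sumℕ n (λ i → b2n (adj G i j))

induced : ∀ {m n} (G : Graph n) (f : Fin m → Fin n) → Injective _≡_ _≡_ f → Graph m
induced G f inj = record
  { adj    = λ i j → adj G (f i) (f j)
  ; sym    = λ i j → sym G (f i) (f j)
  ; irrefl = λ i → irrefl G (f i) }

-- A point of R^{binom n 2}, encoded as a symmetric function Fin n → Fin n → ℚ
-- with zero diagonal (coordinates indexed by unordered pairs {i,j}, i ≠ j).
Point : ℕ → Set
Point n = Fin n → Fin n → ℚ

InP : ∀ {n} → (Fin n → ℕ) → Point n → Set
InP {n} d x =
    (∀ i j → x i j ≡ x j i)
  × (∀ i → x i i ≡ 0ℚ)
  × (∀ i j → 0ℚ ≤ x i j × x i j ≤ 1ℚ)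
  × (∀ j → sumℚ n (λ i → x i j) ≡ (Data.Integer.+ d j) Data.Rational./ 1)

IsVertex : ∀ {n} → (Fin n → ℕ) → Point n → Set
IsVertex {n} d x =
    InP d x
  × (∀ (y z : Point n) (t : ℚ) → InP d y → InP d z → 0ℚ < t → t < 1ℚ →
       (∀ i j → x i j ≡ t * y i j + (1ℚ - t) * z i j) →
       ∀ i j → y i j ≡ z i j)

Decisive : ∀ {n} → (Fin n → ℕ) → Set
Decisive {n} d = ∀ (x : Point n) → IsVertex d x → ∀ i j → (x i j ≡ 0ℚ) ⊎ (x i j ≡ 1ℚ)

DecisiveGraph : ∀ {n} → Graph n → Set
DecisiveGraph G = Decisive (degSeq G)

-- Let H be the subgraph of G induced on the image of f and x a vertex of P(d_H). Extend x to a
-- point of R^{binom n 2} by the adjacency matrix of G on every pair not inside H. It lies in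
-- P(d_G): the column of a vertex of H sums to its H-degree plus its number of neighbours
-- outside H, which is its G-degree. It is a vertex: its entries outside H are 0 or 1, so every
-- convex decomposition keeps them fixed and restricts inside H to a decomposition of x.
-- As d_G is decisive the extension is 0/1, and so is x.
module Submission where

open import Defs hiding (sym)
open import Algebra.Bundles using (CommutativeMonoid)
open import Data.Nat as ℕ using (ℕ; zero; suc)
open import Data.Fin using (Fin; zero; suc)
open import Data.Fin.Properties using (_≟_; suc-injective; any?)
import Data.Integer as ℤ
import Data.Integer.Properties as ℤ
open import Data.Rational
  using (ℚ; 0ℚ; 1ℚ; _+_; _*_; _-_; -_; _≤_; _<_; _/_; Positive; NonNegative; positive; toℚᵘ)
open import Data.Rational.Properties hiding (_≟_)
import Data.Rational.Unnormalised as ℚᵘ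
import Data.Rational.Unnormalised.Properties as ℚᵘ
open import Data.Bool using (true; false)
open import Data.Product using (_×_; _,_; proj₁; proj₂; ∃; map)
open import Data.Sum using (_⊎_; inj₁; inj₂; [_,_]′; swap)
open import Data.Vec.Functional using (Vector)
open import Function using (_∘_; _$_; _⇔_; mk⇔; Equivalence)
open import Function.Definitions using (Injective)
open import Relation.Nullary using (Dec; yes; no; ¬_; ¬?; contradiction)
open import Relation.Unary using (Decidable)
open import Relation.Binary.PropositionalEquality
  using (_≡_; refl; sym; trans; cong; cong₂; subst; module ≡-Reasoning)

infix 4 _∈Image_

_∈Image_ : ∀ {m n} → Fin n → (Fin m → Fin n) → Set
i ∈Image f = ∃ λ a → f a ≡ i

∈Image? : ∀ {m n} (f : Fin m → Fin n) → Decidable (_∈Image f)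
∈Image? f i = any? (λ a → f a ≟ i)

module SumOverImage {c ℓ} (M : CommutativeMonoid c ℓ) where

  open CommutativeMonoid M
    using (Carrier; _≈_; _∙_; ε; setoid; identityˡ; identityʳ; ∙-congˡ; ∙-congʳ)
    renaming (sym to ≈-sym)
  open import Algebra.Properties.CommutativeMonoid.Sum M
    using (sum; sum-cong-≗; sum-cong-≋; ∑-distrib-+; ∑-comm; sum-replicate-zero)
  open import Relation.Binary.Reasoning.Setoid setoid

  keepIf : ∀ {p} {P : Set p} → Dec P → Carrier → Carrier
  keepIf (yes _) x = x
  keepIf (no _)  _ = ε

  keepIf-cong : ∀ {p} {P : Set p} (P? : Dec P) {x y : Carrier} → (P → x ≡ y) →
                keepIf P? x ≡ keepIf P? y
  keepIf-cong (yes p) x≡y = x≡y p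
  keepIf-cong (no _)  _   = refl

  keepIf-reject : ∀ {p} {P : Set p} (P? : Dec P) (x : Carrier) → ¬ P → keepIf P? x ≡ ε
  keepIf-reject (yes p) _ ¬p = contradiction p ¬p
  keepIf-reject (no _)  _ _  = refl

  keepIf-⇔ : ∀ {p q} {P : Set p} {Q : Set q} → P ⇔ Q → (P? : Dec P) (Q? : Dec Q) (x : Carrier) →
             keepIf P? x ≡ keepIf Q? x
  keepIf-⇔ _   (yes _) (yes _) _ = refl
  keepIf-⇔ P⇔Q (yes p) (no ¬q) _ = contradiction (Equivalence.to P⇔Q p) ¬q
  keepIf-⇔ P⇔Q (no ¬p) (yes q) _ = contradiction (Equivalence.from P⇔Q q) ¬p
  keepIf-⇔ _   (no _)  (no _)  _ = refl

  keepIf-complement : ∀ {p} {P : Set p} (P? : Dec P) (x : Carrier) →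
                      x ≈ keepIf P? x ∙ keepIf (¬? P?) x
  keepIf-complement (yes _) x = ≈-sym (identityʳ x)
  keepIf-complement (no _)  x = ≈-sym (identityˡ x)

  sum-keepIf-≟ : ∀ {n} (k : Fin n) (h : Vector Carrier n) → sum (λ i → keepIf (k ≟ i) (h i)) ≈ h k
  sum-keepIf-≟ {suc n} zero h = begin
    h zero ∙ sum {n} (λ _ → ε)  ≈⟨ ∙-congˡ (sum-replicate-zero n) ⟩
    h zero ∙ ε                  ≈⟨ identityʳ (h zero) ⟩
    h zero                      ∎
  sum-keepIf-≟ {suc n} (suc k) h = begin
    ε ∙ sum (λ i → keepIf (suc k ≟ suc i) (h (suc i)))  ≈⟨ identityˡ _ ⟩
    sum (λ i → keepIf (suc k ≟ suc i) (h (suc i)))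
      ≡⟨ sum-cong-≗ (λ i → keepIf-⇔ (mk⇔ suc-injective (cong suc)) (suc k ≟ suc i) (k ≟ i) _) ⟩
    sum (λ i → keepIf (k ≟ i) (h (suc i)))              ≈⟨ sum-keepIf-≟ k (h ∘ suc) ⟩
    h (suc k)                                           ∎

  sum-image : ∀ {m n} {f : Fin m → Fin n} → Injective _≡_ _≡_ f → (h : Vector Carrier n) →
              sum (λ i → keepIf (∈Image? f i) (h i)) ≈ sum (h ∘ f)
  sum-image {m} {f = f} inj h = begin
    sum (λ i → keepIf (∈Image? f i) (h i))          ≈⟨ sum-cong-≋ spread ⟩
    sum (λ i → sum (λ a → keepIf (f a ≟ i) (h i)))  ≈⟨ ∑-comm (λ i a → keepIf (f a ≟ i) (h i)) ⟩
    sum (λ a → sum (λ i → keepIf (f a ≟ i) (h i)))  ≈⟨ sum-cong-≋ (λ a → sum-keepIf-≟ (f a) h) ⟩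
    sum (h ∘ f)                                     ∎
    where
    spread : ∀ i → keepIf (∈Image? f i) (h i) ≈ sum (λ a → keepIf (f a ≟ i) (h i))
    spread i with ∈Image? f i
    ... | yes (a₀ , refl) = ≈-sym $ begin
      sum (λ a → keepIf (f a ≟ f a₀) (h (f a₀)))
        ≡⟨ sum-cong-≗ (λ a → keepIf-⇔ (mk⇔ (sym ∘ inj) (cong f ∘ sym)) (f a ≟ f a₀) (a₀ ≟ a) _) ⟩
      sum (λ a → keepIf (a₀ ≟ a) (h (f a₀)))  ≈⟨ sum-keepIf-≟ a₀ (λ _ → h (f a₀)) ⟩
      h (f a₀)                                ∎
    ... | no ∉ = ≈-sym $ begin
      sum (λ a → keepIf (f a ≟ i) (h i))  ≡⟨ sum-cong-≗ (λ a → keepIf-reject (f a ≟ i) (h i) (∉ ∘ (a ,_))) ⟩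
      sum {m} (λ _ → ε)                   ≈⟨ sum-replicate-zero m ⟩
      ε                                   ∎

  sum-splitImage : ∀ {m n} {f : Fin m → Fin n} → Injective _≡_ _≡_ f → (h : Vector Carrier n) →
                   sum h ≈ sum (h ∘ f) ∙ sum (λ i → keepIf (¬? (∈Image? f i)) (h i))
  sum-splitImage {f = f} inj h = begin
    sum h                                 ≈⟨ sum-cong-≋ (λ i → keepIf-complement (∈Image? f i) (h i)) ⟩
    sum (λ i → inside i ∙ outside i)      ≈⟨ ∑-distrib-+ inside outside ⟩
    sum inside ∙ sum outside              ≈⟨ ∙-congʳ (sum-image inj h) ⟩
    sum (h ∘ f) ∙ sum outside             ∎
    where
    inside outside : Vector Carrier _
    inside  i = keepIf (∈Image? f i) (h i)
    outside i = keepIf (¬? (∈Image? f i)) (h i)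

open SumOverImage +-0-commutativeMonoid using (keepIf; keepIf-cong; sum-splitImage)
open import Algebra.Properties.CommutativeMonoid.Sum +-0-commutativeMonoid using (sum)
open import Algebra.Properties.Group +-0-group using () renaming (∙-cancelʳ to +-cancelʳ)
open import Algebra.Properties.AbelianGroup +-0-abelianGroup using (xyx⁻¹≈y)

sumℚ≡sum : ∀ n (h : Fin n → ℚ) → sumℚ n h ≡ sum h
sumℚ≡sum zero    h = refl
sumℚ≡sum (suc n) h = cong (h zero +_) (sumℚ≡sum n (h ∘ suc))

sumℚ-cong : ∀ n {g h : Fin n → ℚ} → (∀ i → g i ≡ h i) → sumℚ n g ≡ sumℚ n h
sumℚ-cong zero    _   = refl
sumℚ-cong (suc n) g≗h = cong₂ _+_ (g≗h zero) (sumℚ-cong n (g≗h ∘ suc))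

sumℚ-splitImage : ∀ {m n} {f : Fin m → Fin n} → Injective _≡_ _≡_ f → (h : Fin n → ℚ) →
                  sumℚ n h ≡ sumℚ m (h ∘ f) + sumℚ n (λ i → keepIf (¬? (∈Image? f i)) (h i))
sumℚ-splitImage {m} {n} {f} inj h = begin
  sumℚ n h                      ≡⟨ sumℚ≡sum n h ⟩
  sum h                         ≡⟨ sum-splitImage inj h ⟩
  sum (h ∘ f) + sum outside     ≡⟨ cong₂ _+_ (sumℚ≡sum m (h ∘ f)) (sumℚ≡sum n outside) ⟨
  sumℚ m (h ∘ f) + sumℚ n outside ∎
  where
  open ≡-Reasoning
  outside : Fin n → ℚ
  outside i = keepIf (¬? (∈Image? f i)) (h i)

toℚ : ℕ → ℚ
toℚ k = ℤ.+ k / 1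

toℚ-homo-+ : ∀ a b → toℚ (a ℕ.+ b) ≡ toℚ a + toℚ b
toℚ-homo-+ a b = toℚᵘ-injective $ begin
  toℚᵘ (toℚ (a ℕ.+ b))            ≈⟨ toℚᵘ-fromℚᵘ (integer (a ℕ.+ b)) ⟩
  integer (a ℕ.+ b)               ≈⟨ ℚᵘ.*≡* numerators ⟩
  integer a ℚᵘ.+ integer b        ≈⟨ ℚᵘ.+-cong (toℚᵘ-fromℚᵘ (integer a)) (toℚᵘ-fromℚᵘ (integer b)) ⟨
  toℚᵘ (toℚ a) ℚᵘ.+ toℚᵘ (toℚ b)  ≈⟨ toℚᵘ-homo-+ (toℚ a) (toℚ b) ⟨
  toℚᵘ (toℚ a + toℚ b)            ∎
  where
  open ℚᵘ.≃-Reasoning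
  integer : ℕ → ℚᵘ.ℚᵘ
  integer k = ℚᵘ.mkℚᵘ (ℤ.+ k) 0
  numerators : ℤ.+ (a ℕ.+ b) ℤ.* ℤ.+ 1 ≡ (ℤ.+ a ℤ.* ℤ.+ 1 ℤ.+ ℤ.+ b ℤ.* ℤ.+ 1) ℤ.* ℤ.+ 1
  numerators = cong (ℤ._* ℤ.+ 1) $ trans (ℤ.pos-+ a b) $
    sym (cong₂ ℤ._+_ (ℤ.*-identityʳ (ℤ.+ a)) (ℤ.*-identityʳ (ℤ.+ b)))

sumℚ-toℚ : ∀ n (g : Fin n → ℕ) → sumℚ n (toℚ ∘ g) ≡ toℚ (sumℕ n g)
sumℚ-toℚ zero    g = refl
sumℚ-toℚ (suc n) g = trans (cong (toℚ (g zero) +_) (sumℚ-toℚ n (g ∘ suc))) (sym (toℚ-homo-+ (g zero) _))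

+-squeezeˡ : ∀ {a b c d} → a ≤ b → c ≤ d → a + c ≡ b + d → a ≡ b
+-squeezeˡ a≤b c≤d a+c≡b+d = ≤-antisym a≤b (≮⇒≥ λ a<b → <-irrefl a+c≡b+d (+-mono-<-≤ a<b c≤d))

+-squeeze : ∀ {a b c d} → a ≤ b → c ≤ d → a + c ≡ b + d → a ≡ b × c ≡ d
+-squeeze {a} {b} {c} {d} a≤b c≤d a+c≡b+d =
  +-squeezeˡ a≤b c≤d a+c≡b+d ,
  +-squeezeˡ c≤d a≤b (trans (+-comm c a) (trans a+c≡b+d (+-comm b d)))

*-cancelˡ-≡-pos : ∀ r .{{_ : Positive r}} {p q} → r * p ≡ r * q → p ≡ q
*-cancelˡ-≡-pos r rp≡rq =
  ≤-antisym (*-cancelˡ-≤-pos r (≤-reflexive rp≡rq)) (*-cancelˡ-≤-pos r (≤-reflexive (sym rp≡rq)))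

convex-idem : ∀ t c → t * c + (1ℚ - t) * c ≡ c
convex-idem t c = begin
  t * c + (1ℚ - t) * c  ≡⟨ *-distribʳ-+ c t (1ℚ - t) ⟨
  (t + (1ℚ - t)) * c    ≡⟨ cong (_* c) (trans (sym (+-assoc t 1ℚ (- t))) (xyx⁻¹≈y t 1ℚ)) ⟩
  1ℚ * c                ≡⟨ *-identityˡ c ⟩
  c                     ∎
  where open ≡-Reasoning

convex-pinned : ∀ {t y z c} → 0ℚ < t → t < 1ℚ → (c ≤ y × c ≤ z) ⊎ (y ≤ c × z ≤ c) →
                c ≡ t * y + (1ℚ - t) * z → y ≡ c × z ≡ c
convex-pinned {t} {y} {z} {c} 0<t t<1 sameSide c≡mix = pinned sameSide
  where
  s : ℚ
  s = 1ℚ - t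
  instance
    t-pos : Positive t
    t-pos = positive 0<t
    s-pos : Positive s
    s-pos = positive (subst (_< s) (+-inverseʳ t) (+-monoˡ-< (- t) t<1))
    t-nonNeg : NonNegative t
    t-nonNeg = pos⇒nonNeg t
    s-nonNeg : NonNegative s
    s-nonNeg = pos⇒nonNeg s
  split≡mix : t * c + s * c ≡ t * y + s * z
  split≡mix = trans (convex-idem t c) c≡mix
  cancel : t * y ≡ t * c × s * z ≡ s * c → y ≡ c × z ≡ c
  cancel (ty≡tc , sz≡sc) = *-cancelˡ-≡-pos t ty≡tc , *-cancelˡ-≡-pos s sz≡sc
  pinned : (c ≤ y × c ≤ z) ⊎ (y ≤ c × z ≤ c) → y ≡ c × z ≡ c
  pinned (inj₁ (c≤y , c≤z)) =
    cancel (map sym sym (+-squeeze (*-monoˡ-≤-nonNeg t c≤y) (*-monoˡ-≤-nonNeg s c≤z) split≡mix))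
  pinned (inj₂ (y≤c , z≤c)) =
    cancel (+-squeeze (*-monoˡ-≤-nonNeg t y≤c) (*-monoˡ-≤-nonNeg s z≤c) (sym split≡mix))

boolean-pinned : ∀ {t y z c} → c ≡ 0ℚ ⊎ c ≡ 1ℚ → 0ℚ ≤ y × y ≤ 1ℚ → 0ℚ ≤ z × z ≤ 1ℚ →
                 0ℚ < t → t < 1ℚ → c ≡ t * y + (1ℚ - t) * z → y ≡ c × z ≡ c
boolean-pinned (inj₁ refl) (0≤y , _) (0≤z , _) 0<t t<1 = convex-pinned 0<t t<1 (inj₁ (0≤y , 0≤z))
boolean-pinned (inj₂ refl) (_ , y≤1) (_ , z≤1) 0<t t<1 = convex-pinned 0<t t<1 (inj₂ (y≤1 , z≤1))

toℚ-b2n-boolean : ∀ b → toℚ (b2n b) ≡ 0ℚ ⊎ toℚ (b2n b) ≡ 1ℚ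
toℚ-b2n-boolean false = inj₁ refl
toℚ-b2n-boolean true  = inj₂ refl

boolean⇒unitInterval : ∀ {c} → c ≡ 0ℚ ⊎ c ≡ 1ℚ → 0ℚ ≤ c × c ≤ 1ℚ
boolean⇒unitInterval (inj₁ refl) = ≤-refl , <⇒≤ (positive⁻¹ 1ℚ)
boolean⇒unitInterval (inj₂ refl) = <⇒≤ (positive⁻¹ 1ℚ) , ≤-refl

adjacencyPoint : ∀ {n} → Graph n → Point n
adjacencyPoint G i j = toℚ (b2n (adj G i j))

adjacencyPoint-InP : ∀ {n} (G : Graph n) → InP (degSeq G) (adjacencyPoint G)
adjacencyPoint-InP {n} G =
  (λ i j → cong (toℚ ∘ b2n) (Graph.sym G i j)) ,
  (λ i → cong (toℚ ∘ b2n) (irrefl G i)) ,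
  (λ i j → boolean⇒unitInterval (toℚ-b2n-boolean (adj G i j))) ,
  (λ j → sumℚ-toℚ n (λ i → b2n (adj G i j)))

module InducedSubgraph {m n} (G : Graph n) (f : Fin m → Fin n) (inj : Injective _≡_ _≡_ f) where

  A : Point n
  A = adjacencyPoint G

  dG : Fin n → ℕ
  dG = degSeq G

  dH : Fin m → ℕ
  dH = degSeq (induced G f inj)

  AgreesOffImage : Point n → Set
  AgreesOffImage W = ∀ i j → ¬ i ∈Image f ⊎ ¬ j ∈Image f → W i j ≡ A i j

  Extends : Point n → Point m → Set
  Extends W x = ∀ a b → W (f a) (f b) ≡ x a b

  data PairView : Fin n → Fin n → Set where
    inside  : ∀ a b → PairView (f a) (f b)
    outside : ∀ {i j} → ¬ i ∈Image f ⊎ ¬ j ∈Image f → PairView i j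

  pairView : ∀ i j → PairView i j
  pairView i j with ∈Image? f i | ∈Image? f j
  ... | yes (a , refl) | yes (b , refl) = inside a b
  ... | yes _          | no j∉          = outside (inj₂ j∉)
  ... | no i∉          | _              = outside (inj₁ i∉)

  outsideColumn : Fin m → ℚ
  outsideColumn b = sumℚ n (λ i → keepIf (¬? (∈Image? f i)) (A i (f b)))

  columnSum-split : ∀ {W x} → AgreesOffImage W → Extends W x →
                    ∀ b → sumℚ n (λ i → W i (f b)) ≡ sumℚ m (λ a → x a b) + outsideColumn b
  columnSum-split {W} {x} agrees extends b = begin
    sumℚ n (λ i → W i (f b))
      ≡⟨ sumℚ-splitImage inj (λ i → W i (f b)) ⟩
    sumℚ m (λ a → W (f a) (f b)) + sumℚ n (λ i → keepIf (¬? (∈Image? f i)) (W i (f b)))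
      ≡⟨ cong₂ _+_ (sumℚ-cong m (λ a → extends a b)) (sumℚ-cong n outsideAgrees) ⟩
    sumℚ m (λ a → x a b) + outsideColumn b
      ∎
    where
    open ≡-Reasoning
    outsideAgrees : ∀ i → keepIf (¬? (∈Image? f i)) (W i (f b)) ≡ keepIf (¬? (∈Image? f i)) (A i (f b))
    outsideAgrees i = keepIf-cong (¬? (∈Image? f i)) (λ i∉ → agrees i (f b) (inj₁ i∉))

  degree-split : ∀ b → toℚ (dG (f b)) ≡ toℚ (dH b) + outsideColumn b
  degree-split b = begin
    toℚ (dG (f b))                                  ≡⟨ sumℚ-toℚ n _ ⟨
    sumℚ n (λ i → A i (f b))                        ≡⟨ columnSum-split (λ _ _ _ → refl) (λ _ _ → refl) b ⟩
    sumℚ m (λ a → A (f a) (f b)) + outsideColumn b  ≡⟨ cong (_+ outsideColumn b) (sumℚ-toℚ m _) ⟩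
    toℚ (dH b) + outsideColumn b                    ∎
    where open ≡-Reasoning

  columnSum-restrict : ∀ {W x} → AgreesOffImage W → Extends W x → ∀ b →
                       (sumℚ n (λ i → W i (f b)) ≡ toℚ (dG (f b))) ⇔ (sumℚ m (λ a → x a b) ≡ toℚ (dH b))
  columnSum-restrict agrees extends b = mk⇔
    (λ W-col → +-cancelʳ (outsideColumn b) _ _ $
      trans (sym (columnSum-split agrees extends b)) (trans W-col (degree-split b)))
    (λ x-col → trans (columnSum-split agrees extends b) $
      trans (cong (_+ outsideColumn b) x-col) (sym (degree-split b)))

  InP-lift : ∀ {W x} → AgreesOffImage W → Extends W x → InP dH x → InP dG W
  InP-lift {W} {x} agrees extends = lift (adjacencyPoint-InP G)
    where
    lift : InP dG A → InP dH x → InP dG W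
    lift (A-sym , A-diag , A-bounds , A-cols) (x-sym , x-diag , x-bounds , x-cols) =
      W-sym , W-diag , W-bounds , W-cols
      where
      W-sym : ∀ i j → W i j ≡ W j i
      W-sym i j with pairView i j
      ... | inside a b  = trans (extends a b) (trans (x-sym a b) (sym (extends b a)))
      ... | outside off = trans (agrees i j off) (trans (A-sym i j) (sym (agrees j i (swap off))))

      W-diag : ∀ i → W i i ≡ 0ℚ
      W-diag i with ∈Image? f i
      ... | yes (a , refl) = trans (extends a a) (x-diag a)
      ... | no i∉          = trans (agrees i i (inj₁ i∉)) (A-diag i)

      W-bounds : ∀ i j → 0ℚ ≤ W i j × W i j ≤ 1ℚ
      W-bounds i j with pairView i j
      ... | inside a b  = subst (λ v → 0ℚ ≤ v × v ≤ 1ℚ) (sym (extends a b)) (x-bounds a b)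
      ... | outside off = subst (λ v → 0ℚ ≤ v × v ≤ 1ℚ) (sym (agrees i j off)) (A-bounds i j)

      W-cols : ∀ j → sumℚ n (λ i → W i j) ≡ toℚ (dG j)
      W-cols j with ∈Image? f j
      ... | yes (b , refl) = Equivalence.from (columnSum-restrict agrees extends b) (x-cols b)
      ... | no j∉          = trans (sumℚ-cong n (λ i → agrees i j (inj₂ j∉))) (A-cols j)

  InP-restrict : ∀ {W x} → AgreesOffImage W → Extends W x → InP dG W → InP dH x
  InP-restrict agrees extends (W-sym , W-diag , W-bounds , W-cols) =
    (λ a b → trans (sym (extends a b)) (trans (W-sym (f a) (f b)) (extends b a))) ,
    (λ a → trans (sym (extends a a)) (W-diag (f a))) ,
    (λ a b → subst (λ v → 0ℚ ≤ v × v ≤ 1ℚ) (extends a b) (W-bounds (f a) (f b))) ,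
    (λ b → Equivalence.to (columnSum-restrict agrees extends b) (W-cols (f b)))

  extend : Point m → Point n
  extend x i j with ∈Image? f i | ∈Image? f j
  ... | yes (a , _) | yes (b , _) = x a b
  ... | _           | _           = A i j

  extend-extends : ∀ x → Extends (extend x) x
  extend-extends x a b with ∈Image? f (f a) | ∈Image? f (f b)
  ... | yes (_ , fa′≡fa) | yes (_ , fb′≡fb) = cong₂ x (inj fa′≡fa) (inj fb′≡fb)
  ... | yes _            | no fb∉           = contradiction (b , refl) fb∉
  ... | no fa∉           | _                = contradiction (a , refl) fa∉

  extend-agreesOffImage : ∀ x → AgreesOffImage (extend x)
  extend-agreesOffImage x i j off with ∈Image? f i | ∈Image? f j
  ... | yes i∈ | yes j∈ = contradiction off [ _$ i∈ , _$ j∈ ]′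
  ... | yes _  | no _   = refl
  ... | no _   | _      = refl

  extend-isVertex : ∀ x → IsVertex dH x → IsVertex dG (extend x)
  extend-isVertex x (x-InP , x-extreme) =
    InP-lift (extend-agreesOffImage x) (extend-extends x) x-InP , extend-extreme
    where
    extend-extreme : ∀ Y Z t → InP dG Y → InP dG Z → 0ℚ < t → t < 1ℚ →
                     (∀ i j → extend x i j ≡ t * Y i j + (1ℚ - t) * Z i j) → ∀ i j → Y i j ≡ Z i j
    extend-extreme Y Z t Y-InP@(_ , _ , Y-bounds , _) Z-InP@(_ , _ , Z-bounds , _) 0<t t<1 x≡mix = Y≗Z
      where
      pinnedOff : ∀ i j → ¬ i ∈Image f ⊎ ¬ j ∈Image f → Y i j ≡ A i j × Z i j ≡ A i j
      pinnedOff i j off =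
        boolean-pinned (toℚ-b2n-boolean (adj G i j)) (Y-bounds i j) (Z-bounds i j) 0<t t<1
          (trans (sym (extend-agreesOffImage x i j off)) (x≡mix i j))

      restrict : Point n → Point m
      restrict W a b = W (f a) (f b)

      restrict-InP : ∀ {W} → InP dG W → AgreesOffImage W → InP dH (restrict W)
      restrict-InP W-InP agrees = InP-restrict agrees (λ _ _ → refl) W-InP

      Y≗Z-inside : ∀ a b → Y (f a) (f b) ≡ Z (f a) (f b)
      Y≗Z-inside = x-extreme (restrict Y) (restrict Z) t
        (restrict-InP Y-InP (λ i j → proj₁ ∘ pinnedOff i j))
        (restrict-InP Z-InP (λ i j → proj₂ ∘ pinnedOff i j))
        0<t t<1 (λ a b → trans (sym (extend-extends x a b)) (x≡mix (f a) (f b)))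

      Y≗Z : ∀ i j → Y i j ≡ Z i j
      Y≗Z i j with pairView i j
      ... | inside a b  = Y≗Z-inside a b
      ... | outside off = trans (proj₁ (pinnedOff i j off)) (sym (proj₂ (pinnedOff i j off)))

lemma4 : ∀ (n : ℕ) (G : Graph n) → DecisiveGraph G →
           ∀ (m : ℕ) (f : Fin m → Fin n) (inj : Injective _≡_ _≡_ f) →
           DecisiveGraph (induced G f inj)
lemma4 n G decisive m f inj x x-vertex a b =
  subst (λ v → v ≡ 0ℚ ⊎ v ≡ 1ℚ) (extend-extends x a b)
    (decisive (extend x) (extend-isVertex x x-vertex) (f a) (f b))
  where open InducedSubgraph G f inj
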